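{- Let $\mathbf{A}$ be any (possibly empty) composition of operators from $\{\mathbf{S},\mathbf{R}\}$. For every permutation $\theta$ sorted by $\mathbf{S}\circ\mathbf{A}$, the trees $\mathrm{T}_{\mathrm{in}}(\Phi_{\mathbf{A}}(\theta))$ and $\mathrm{T}_{\mathrm{in}}(\theta)$ have the same underlying unlabelled binary tree. That is, $\Phi_{\mathbf{A}}$ preserves the shape of the in-order tree.
   Context: Notation and conventions. - Permutations are in one-line notation, with composition $(\lambda\circ\sigma)(i)=\lambda(\sigma(i))$. - A sequence of distinct integers is identified with the permutation order-isomorphic to it. - $\mathrm{Av}(231)$ (resp. $\mathrm{Av}(132)$) is the set of permutations avoiding $231$ (resp. $132$). Operators. - $\mathbf{S}(\varepsilon)=\varepsilon$ and $\mathbf{S}(\alpha n\beta)=\mathbf{S}(\alpha)\mathbf{S}(\beta)n$, where $n$ is the maximum entry. - $\mathbf{R}$ is reversal. - $\theta$ is sorted by $\mathbf{S}\circ\mathbf{A}$ if $\mathbf{S}(\mathbf{A}(\theta))$ is the identity, equivalently $\mathbf{A}(\theta)\in\mathrm{Av}(231)$. The bijection $P$ and the map $\Phi_{\mathbf{A}}$. - $\alpha\oplus\beta=\alpha(\beta+|\alpha|)$ and $\alpha\ominus\beta=(\alpha+|\beta|)\beta$. - $P:\mathrm{Av}(231)\to\mathrm{Av}(132)$ is defined by $P(\varepsilon)=\varepsilon$ and $P(\alpha\oplus(1\ominus\beta))=(P(\alpha)\oplus1)\ominus P(\beta)$, using the unique decomposition of nonempty $231$-avoiders as $\alpha\oplus(1\ominus\beta)$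 with $\alpha,\beta\in\mathrm{Av}(231)$. - $\lambda_\pi$ is defined by $P(\pi)=\lambda_\pi\circ\pi$. - $\Phi_{\mathbf{A}}(\theta)=\lambda_{\mathbf{A}(\theta)}\circ\theta$. Trees. - A binary tree is decreasing if every child's label is smaller than its parent's. - The in-order reading is (left subtree reading)(root)(right subtree reading). - $\mathrm{T}_{\mathrm{in}}(\pi)$ is the unique decreasing binary tree with in-order reading $\pi$. -}

module Defs where

open import Data.Nat using (ℕ; zero; suc; _+_; _∸_; _<_; _⊔_; _≡ᵇ_)
open import Data.Bool using (if_then_else_)
open import Data.List using (List; []; _∷_; _++_; [_]; map; length; reverse; foldr; upTo)
open import Data.Product using (_×_; _,_)
open import Data.Unit using (⊤)
open import Relation.Binary.PropositionalEquality using (_≡_)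
open import Data.List.Relation.Binary.Permutation.Propositional using (_↭_)

-- Permutations in one-line notation, as lists of naturals with values 1..n.
idPerm : ℕ → List ℕ
idPerm n = map suc (upTo n)

IsPerm : List ℕ → Set
IsPerm θ = θ ↭ idPerm (length θ)

-- maximum entry (lists here have positive entries)
maxL : List ℕ → ℕ
maxL = foldr _⊔_ 0

breakAt : ℕ → List ℕ → List ℕ × List ℕ
breakAt v [] = [] , []
breakAt v (x ∷ xs) with x ≡ᵇ v
... | Data.Bool.true = [] , xs
... | Data.Bool.false with breakAt v xs
...   | a , b = x ∷ a , b

-- stack sorting S(α n β) = S(α) S(β) n  (fuel = length, always sufficient)
stackSortF : ℕ → List ℕ → List ℕ
stackSortF zero _ = []
stackSortF (suc f) [] = []
stackSortF (suc f) (x ∷ xs) with breakAt (maxL (x ∷ xs)) (x ∷ xs)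
... | α , β = stackSortF f α ++ stackSortF f β ++ [ maxL (x ∷ xs) ]

S : List ℕ → List ℕ
S xs = stackSortF (length xs) xs

R : List ℕ → List ℕ
R = reverse

data Op : Set where
  opS opR : Op

applyOp : Op → List ℕ → List ℕ
applyOp opS = S
applyOp opR = R

applyOps : List Op → List ℕ → List ℕ
applyOps [] θ = θ
applyOps (o ∷ os) θ = applyOp o (applyOps os θ)

SortedBy : List Op → List ℕ → Set
SortedBy A θ = S (applyOps A θ) ≡ idPerm (length θ)

-- The bijection P : Av(231) → Av(132):
-- a nonempty 231-avoider π = α ⊕ (1 ⊖ β) has its maximum right after α
-- (α occupies values 1..|α|, the shifted β values |α|+1..n-1), and
-- P(π) = (P(α) ⊕ 1) ⊖ P(β) = (P(α)+|β|) (|α|+1+|β|) P(β).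
-- (Only ever applied to 231-avoiders; fuel = length.)
PF : ℕ → List ℕ → List ℕ
PF zero _ = []
PF (suc f) [] = []
PF (suc f) (x ∷ xs) with breakAt (maxL (x ∷ xs)) (x ∷ xs)
... | α , β' =
  map (_+ length β') (PF f α) ++ [ length α + 1 + length β' ] ++ PF f (map (_∸ length α) β')

P : List ℕ → List ℕ
P π = PF (length π) π

-- relabel π σ v = σ(i) where π(i) = v ; i.e. the map λ with σ = λ ∘ π
relabel : List ℕ → List ℕ → ℕ → ℕ
relabel [] _ v = 0
relabel (_ ∷ _) [] v = 0
relabel (x ∷ xs) (y ∷ ys) v = if x ≡ᵇ v then y else relabel xs ys v

lam : List ℕ → ℕ → ℕ
lam π = relabel π (P π)

Phi : List Op → List ℕ → List ℕ
Phi A θ = map (lam (applyOps A θ)) θ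

data BTree : Set where
  leaf : BTree
  node : BTree → ℕ → BTree → BTree

inorder : BTree → List ℕ
inorder leaf = []
inorder (node l x r) = inorder l ++ x ∷ inorder r

RootBelow : ℕ → BTree → Set
RootBelow v leaf = ⊤
RootBelow v (node _ x _) = x < v

IsDecreasing : BTree → Set
IsDecreasing leaf = ⊤
IsDecreasing (node l x r) = RootBelow x l × RootBelow x r × IsDecreasing l × IsDecreasing r

-- T_in(π) is the (unique) decreasing binary tree t with inorder t ≡ π
IsTin : List ℕ → BTree → Set
IsTin π t = IsDecreasing t × inorder t ≡ π

data Shape : Set where
  leaf : Shape
  node : Shape → Shape → Shape

shape : BTree → Shape
shape leaf = leaf
shape (node l _ r) = node (shape l) (shape r)

-- The shape of the decreasing tree T_in(σ) is determined by its ancestor relation: x is an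
-- ancestor of y iff y < x and every entry of σ between them is below x.  Stack sorting S(α n β)
-- = S(α) S(β) n and reversal both preserve this relation, so every ancestor pair of θ is one of
-- π = A(θ).  Sortedness by S ∘ A makes π a 231-avoider α ⊕ (1 ⊖ β), and then
-- P(π) = (P(α) ⊕ 1) ⊖ P(β) sends the maximum to the maximum, shifts α up by |β| and β down by
-- |α|; by induction λ_π is increasing on the ancestor pairs of π, hence of θ.  A relabelling
-- that is increasing on ancestor pairs keeps each root above its subtrees, so T_in(λ_π ∘ θ) has
-- the same shape as T_in(θ).  Distinctness of the entries of θ is never used.
module Submission where

open import Data.Bool using (true; false)
open import Data.Empty using (⊥-elim)
open import Data.List using (List; []; _∷_; _++_; [_]; map; length; reverse; applyUpTo)
open import Data.List.Properties
  using (++-assoc; ++-identityʳ; length-++; length-map; map-++; reverse-++; ∷-injective; map-upTo)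
open import Data.List.Membership.Propositional using (_∈_; _∉_)
open import Data.List.Membership.Propositional.Properties using (∈-++⁺ˡ; ∈-++⁺ʳ; ∈-++⁻; ∈-insert; ∈-map⁺)
open import Data.List.Relation.Unary.All as All using (All; []; _∷_)
open import Data.List.Relation.Unary.All.Properties using (++⁺; map⁺)
open import Data.List.Relation.Unary.Any using (here; there)
open import Data.List.Relation.Binary.Permutation.Propositional using (_↭_; ↭-refl; ↭-sym; ↭-trans)
open import Data.List.Relation.Binary.Permutation.Propositional.Properties
  using (∈-resp-↭; All-resp-↭; ↭-length; ++⁺ʳ; ∷↭∷ʳ; ↭-reverse) renaming (++⁺ to ↭-++⁺)
open import Data.Nat using (ℕ; zero; suc; _+_; _∸_; _<_; _≤_; _≡ᵇ_; _<?_; z≤n; s≤s; s≤s⁻¹)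
open import Data.Nat.Properties
open import Data.Product using (_×_; _,_; proj₁; proj₂; ∃)
open import Data.Product.Properties using (,-injective)
open import Data.Sum using (_⊎_; inj₁; inj₂)
open import Function using (_∘_)
open import Relation.Nullary using (yes; no)
open import Relation.Binary.PropositionalEquality hiding ([_])

open import Defs

+-right-comm : ∀ m n o → m + n + o ≡ m + o + n
+-right-comm m n o = trans (+-assoc m n o) (trans (cong (m +_) (+-comm n o)) (sym (+-assoc m o n)))

m+1+n≡1+m+n : ∀ m n → m + 1 + n ≡ suc (m + n)
m+1+n≡1+m+n m n = trans (+-assoc m 1 n) (+-suc m n)

≡ᵇ-refl : ∀ n → (n ≡ᵇ n) ≡ true
≡ᵇ-refl zero = refl
≡ᵇ-refl (suc n) = ≡ᵇ-refl n

≢⇒≡ᵇ≡false : ∀ {m n} → m ≢ n → (m ≡ᵇ n) ≡ false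
≢⇒≡ᵇ≡false {zero} {zero} m≢n = ⊥-elim (m≢n refl)
≢⇒≡ᵇ≡false {zero} {suc n} _ = refl
≢⇒≡ᵇ≡false {suc m} {zero} _ = refl
≢⇒≡ᵇ≡false {suc m} {suc n} m≢n = ≢⇒≡ᵇ≡false (m≢n ∘ cong suc)

length-++-∷ : ∀ (α : List ℕ) {m} β → length (α ++ m ∷ β) ≡ suc (length α + length β)
length-++-∷ α β = trans (length-++ α) (+-suc (length α) (length β))

length-++-∷≤ : ∀ (α : List ℕ) {m β f} → length (α ++ m ∷ β) ≤ suc f → length α ≤ f × length β ≤ f
length-++-∷≤ α {m} {β} {f} σ≤ = ≤-trans (m≤m+n _ _) α+β≤ , ≤-trans (m≤n+m _ _) α+β≤
  where
    α+β≤ : length α + length β ≤ f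
    α+β≤ = s≤s⁻¹ (subst (_≤ suc f) (length-++-∷ α β) σ≤)

∈-++-∷⁺ : ∀ (α : List ℕ) {m β y} → y ∈ α ++ β → y ∈ α ++ m ∷ β
∈-++-∷⁺ α y∈ with ∈-++⁻ α y∈
... | inj₁ y∈α = ∈-++⁺ˡ y∈α
... | inj₂ y∈β = ∈-++⁺ʳ α (there y∈β)

∈-++-∷⁻ : ∀ (α : List ℕ) {m β y} → y ∈ α ++ m ∷ β → y ≢ m → y ∈ α ++ β
∈-++-∷⁻ α y∈ y≢m with ∈-++⁻ α y∈
... | inj₁ y∈α = ∈-++⁺ˡ y∈α
... | inj₂ (here y≡m) = ⊥-elim (y≢m y≡m)
... | inj₂ (there y∈β) = ∈-++⁺ʳ α y∈β

[]≢++∷ : ∀ (p : List ℕ) {x q} → [] ≢ p ++ x ∷ q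
[]≢++∷ [] ()
[]≢++∷ (_ ∷ _) ()

++-cancel-length : ∀ (p p′ q q′ : List ℕ) → length p ≡ length p′ → p ++ q ≡ p′ ++ q′ → p ≡ p′ × q ≡ q′
++-cancel-length [] [] q q′ _ e = refl , e
++-cancel-length (x ∷ p) (_ ∷ p′) q q′ l e with ∷-injective e
... | refl , e′ with ++-cancel-length p p′ q q′ (suc-injective l) e′
...   | refl , q≡ = refl , q≡

window-split : ∀ (window back d : List ℕ) {m β} → window ++ back ≡ d ++ m ∷ β →
               (∃ λ c → d ≡ window ++ c) ⊎ m ∈ window
window-split [] back d _ = inj₁ (d , refl)
window-split (w ∷ window) back [] e = inj₂ (here (sym (proj₁ (∷-injective e))))
window-split (w ∷ window) back (_ ∷ d) e with ∷-injective e
... | refl , e′ with window-split window back d e′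
...   | inj₁ (c , d≡) = inj₁ (c , cong (w ∷_) d≡)
...   | inj₂ m∈ = inj₂ (there m∈)

factor-split : ∀ (front window back α : List ℕ) {m β} → front ++ window ++ back ≡ α ++ m ∷ β →
               (∃ λ c → α ≡ front ++ window ++ c) ⊎ (∃ λ c → β ≡ c ++ window ++ back) ⊎ m ∈ window
factor-split [] window back α e with window-split window back α e
... | inj₁ α≡ = inj₁ α≡
... | inj₂ m∈ = inj₂ (inj₂ m∈)
factor-split (_ ∷ front) window back [] e = inj₂ (inj₁ (front , sym (proj₂ (∷-injective e))))
factor-split (f ∷ front) window back (_ ∷ α) e with ∷-injective e
... | refl , e′ with factor-split front window back α e′
...   | inj₁ (c , α≡) = inj₁ (c , cong (f ∷_) α≡)
...   | inj₂ rest = inj₂ rest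

maxL-≤ : ∀ {m σ} → All (_≤ m) σ → maxL σ ≤ m
maxL-≤ [] = z≤n
maxL-≤ (x≤m ∷ σ≤m) = ⊔-lub x≤m (maxL-≤ σ≤m)

∈⇒≤maxL : ∀ {v σ} → v ∈ σ → v ≤ maxL σ
∈⇒≤maxL {σ = x ∷ σ} (here refl) = m≤m⊔n x (maxL σ)
∈⇒≤maxL {σ = x ∷ σ} (there v∈σ) = ≤-trans (∈⇒≤maxL v∈σ) (m≤n⊔m x (maxL σ))

-- α < m (rather than α ≤ m) puts m at the first occurrence of the maximum, where breakAt splits.
data MaxView : List ℕ → Set where
  empty : MaxView []
  atMax : ∀ {α m β} → All (_< m) α → All (_≤ m) β → MaxView (α ++ m ∷ β)

maxView : ∀ σ → MaxView σ
maxView [] = empty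
maxView (x ∷ σ) with maxView σ
... | empty = atMax {[]} [] []
... | atMax {α} {m} {β} α<m β≤m with x <? m
...   | yes x<m = atMax {x ∷ α} (x<m ∷ α<m) β≤m
...   | no x≮m = atMax {[]} [] (++⁺ (All.map (λ u<m → ≤-trans (<⇒≤ u<m) m≤x) α<m)
                                     (m≤x ∷ All.map (λ u≤m → ≤-trans u≤m m≤x) β≤m))
  where
    m≤x : m ≤ x
    m≤x = ≮⇒≥ x≮m

atMax-≤ : ∀ {α m β} → All (_< m) α → All (_≤ m) β → All (_≤ m) (α ++ m ∷ β)
atMax-≤ α<m β≤m = ++⁺ (All.map <⇒≤ α<m) (≤-refl ∷ β≤m)

maxL-atMax : ∀ {α m β} → All (_< m) α → All (_≤ m) β → maxL (α ++ m ∷ β) ≡ m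
maxL-atMax {α} α<m β≤m = ≤-antisym (maxL-≤ (atMax-≤ α<m β≤m)) (∈⇒≤maxL (∈-insert α))

breakAt-atMax : ∀ {α m β} → All (_< m) α → breakAt m (α ++ m ∷ β) ≡ (α , β)
breakAt-atMax {m = m} [] rewrite ≡ᵇ-refl m = refl
breakAt-atMax {x ∷ _} (x<m ∷ α<m) rewrite ≢⇒≡ᵇ≡false (<⇒≢ x<m) =
  cong (λ p → x ∷ proj₁ p , proj₂ p) (breakAt-atMax α<m)

atMax-unique : ∀ {xs p ys us q vs} → All (_< p) xs → All (_≤ p) ys → All (_< q) us → All (_≤ q) vs →
               xs ++ p ∷ ys ≡ us ++ q ∷ vs → xs ≡ us × ys ≡ vs
atMax-unique {p = p} xs<p ys≤p us<q vs≤q e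
  with refl ← trans (sym (maxL-atMax xs<p ys≤p)) (trans (cong maxL e) (maxL-atMax us<q vs≤q)) =
  ,-injective (trans (sym (breakAt-atMax xs<p)) (trans (cong (breakAt p) e) (breakAt-atMax us<q)))

unfold-atMax : ∀ {B : Set} (h : List ℕ → B) (g : ℕ → List ℕ × List ℕ → B) →
               (∀ x xs → h (x ∷ xs) ≡ g (maxL (x ∷ xs)) (breakAt (maxL (x ∷ xs)) (x ∷ xs))) →
               ∀ {α m β} → All (_< m) α → All (_≤ m) β → h (α ++ m ∷ β) ≡ g m (α , β)
unfold-atMax h g h-∷ {α} {m} {β} α<m β≤m = trans (unfold α) split-at-m
  where
    σ : List ℕ
    σ = α ++ m ∷ β
    unfold : ∀ α → h (α ++ m ∷ β) ≡ g (maxL (α ++ m ∷ β)) (breakAt (maxL (α ++ m ∷ β)) (α ++ m ∷ β))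
    unfold [] = h-∷ m β
    unfold (x ∷ α) = h-∷ x (α ++ m ∷ β)
    split-at-m : g (maxL σ) (breakAt (maxL σ) σ) ≡ g m (α , β)
    split-at-m rewrite maxL-atMax α<m β≤m | breakAt-atMax {β = β} α<m = refl

stackSortF-atMax : ∀ f {α m β} → All (_< m) α → All (_≤ m) β →
                   stackSortF (suc f) (α ++ m ∷ β) ≡ stackSortF f α ++ stackSortF f β ++ [ m ]
stackSortF-atMax f =
  unfold-atMax (stackSortF (suc f)) (λ m (α , β) → stackSortF f α ++ stackSortF f β ++ [ m ]) (λ _ _ → refl)

PF-atMax : ∀ f {α m β} → All (_< m) α → All (_≤ m) β →
           PF (suc f) (α ++ m ∷ β) ≡
           map (_+ length β) (PF f α) ++ length α + 1 + length β ∷ PF f (map (_∸ length α) β)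
PF-atMax f = unfold-atMax (PF (suc f))
  (λ _ (α , β) → map (_+ length β) (PF f α) ++ length α + 1 + length β ∷ PF f (map (_∸ length α) β))
  (λ _ _ → refl)

stackSortF-↭ : ∀ f σ → length σ ≤ f → stackSortF f σ ↭ σ
stackSortF-↭ zero [] _ = ↭-refl
stackSortF-↭ (suc f) σ σ≤ with maxView σ
... | empty = ↭-refl
... | atMax {α} {m} {β} α<m β≤m rewrite stackSortF-atMax f α<m β≤m with length-++-∷≤ α σ≤
...   | α≤ , β≤ =
  ↭-++⁺ (stackSortF-↭ f α α≤) (↭-trans (++⁺ʳ [ m ] (stackSortF-↭ f β β≤)) (↭-sym (∷↭∷ʳ m β)))

-- x is a proper ancestor of y in T_in(σ) iff y < x and some factor of σ containing both is bounded by x.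
data Ancestor (σ : List ℕ) (x y : ℕ) : Set where
  ancestor : ∀ front window back → σ ≡ front ++ window ++ back →
             x ∈ window → y ∈ window → All (_≤ x) window → y < x → Ancestor σ x y

Ancestor-whole : ∀ {σ x y} → x ∈ σ → y ∈ σ → All (_≤ x) σ → y < x → Ancestor σ x y
Ancestor-whole {σ} = ancestor [] σ [] (sym (++-identityʳ σ))

Ancestor-∈ : ∀ {σ x y} → Ancestor σ x y → x ∈ σ × y ∈ σ
Ancestor-∈ (ancestor front window back refl x∈ y∈ _ _) =
  ∈-++⁺ʳ front (∈-++⁺ˡ x∈) , ∈-++⁺ʳ front (∈-++⁺ˡ y∈)

Ancestor-++⁺ˡ : ∀ {σ x y} τ → Ancestor σ x y → Ancestor (σ ++ τ) x y
Ancestor-++⁺ˡ τ (ancestor front window back refl x∈ y∈ w≤x y<x) =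
  ancestor front window (back ++ τ) reassoc x∈ y∈ w≤x y<x
  where
    reassoc : (front ++ window ++ back) ++ τ ≡ front ++ window ++ back ++ τ
    reassoc = trans (++-assoc front (window ++ back) τ) (cong (front ++_) (++-assoc window back τ))

Ancestor-++⁺ʳ : ∀ {σ x y} ρ → Ancestor σ x y → Ancestor (ρ ++ σ) x y
Ancestor-++⁺ʳ ρ (ancestor front window back refl x∈ y∈ w≤x y<x) =
  ancestor (ρ ++ front) window back (sym (++-assoc ρ front (window ++ back))) x∈ y∈ w≤x y<x

Ancestor-reverse⁺ : ∀ {σ x y} → Ancestor σ x y → Ancestor (reverse σ) x y
Ancestor-reverse⁺ (ancestor front window back refl x∈ y∈ w≤x y<x) =
  ancestor (reverse back) (reverse window) (reverse front) reverse-factor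
    (∈-resp-↭ reversed x∈) (∈-resp-↭ reversed y∈) (All-resp-↭ reversed w≤x) y<x
  where
    reversed : window ↭ reverse window
    reversed = ↭-sym (↭-reverse window)
    reverse-factor : reverse (front ++ window ++ back) ≡ reverse back ++ reverse window ++ reverse front
    reverse-factor = begin
      reverse (front ++ window ++ back)                 ≡⟨ reverse-++ front (window ++ back) ⟩
      reverse (window ++ back) ++ reverse front         ≡⟨ cong (_++ reverse front) (reverse-++ window back) ⟩
      (reverse back ++ reverse window) ++ reverse front ≡⟨ ++-assoc (reverse back) (reverse window) (reverse front) ⟩
      reverse back ++ reverse window ++ reverse front   ∎
      where open ≡-Reasoning

Ancestor-map⁺ : ∀ {σ x y} (g : ℕ → ℕ) → (∀ {u v} → u ≤ v → g u ≤ g v) → (y < x → g y < g x) →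
                Ancestor σ x y → Ancestor (map g σ) (g x) (g y)
Ancestor-map⁺ g g-mono g-< (ancestor front window back refl x∈ y∈ w≤x y<x) =
  ancestor (map g front) (map g window) (map g back) map-factor
    (∈-map⁺ g x∈) (∈-map⁺ g y∈) (map⁺ (All.map g-mono w≤x)) (g-< y<x)
  where
    map-factor : map g (front ++ window ++ back) ≡ map g front ++ map g window ++ map g back
    map-factor = trans (map-++ g front (window ++ back)) (cong (map g front ++_) (map-++ g window back))

data Around (α : List ℕ) (m : ℕ) (β : List ℕ) : ℕ → ℕ → Set where
  inLeft  : ∀ {x y} → Ancestor α x y → Around α m β x y
  inRight : ∀ {x y} → Ancestor β x y → Around α m β x y
  fromMax : ∀ {y} → y < m → y ∈ α ++ β → Around α m β m y

Ancestor-around : ∀ {α m β x y} → All (_≤ m) (α ++ m ∷ β) → Ancestor (α ++ m ∷ β) x y → Around α m β x y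
Ancestor-around {α} {m} {β} {x} {y} σ≤m anc@(ancestor front window back e x∈ y∈ w≤x y<x)
  with factor-split front window back α (sym e)
... | inj₁ (c , α≡) = inLeft (ancestor front window c α≡ x∈ y∈ w≤x y<x)
... | inj₂ (inj₁ (c , β≡)) = inRight (ancestor c window back β≡ x∈ y∈ w≤x y<x)
... | inj₂ (inj₂ m∈) =
  subst (λ z → Around α m β z y) (sym x≡m) (fromMax y<m (∈-++-∷⁻ α y∈σ (<⇒≢ y<m)))
  where
    x≡m : x ≡ m
    x≡m = ≤-antisym (All.lookup σ≤m (proj₁ (Ancestor-∈ anc))) (All.lookup w≤x m∈)
    y<m : y < m
    y<m = subst (y <_) x≡m y<x
    y∈σ : y ∈ α ++ m ∷ β
    y∈σ = proj₂ (Ancestor-∈ anc)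

-- In the fromMax case no unfolding is needed: the maximum is an ancestor of everything in any arrangement.
stackSortF-Ancestor : ∀ f σ {x y} → length σ ≤ f → Ancestor σ x y → Ancestor (stackSortF f σ) x y
stackSortF-Ancestor zero [] _ anc = anc
stackSortF-Ancestor (suc f) σ σ≤ anc with maxView σ
... | empty = anc
... | atMax {α} {m} {β} α<m β≤m with Ancestor-around (atMax-≤ α<m β≤m) anc | length-++-∷≤ α σ≤
...   | fromMax y<m y∈ | _ =
  Ancestor-whole (∈-resp-↭ sorted (∈-insert α)) (∈-resp-↭ sorted (∈-++-∷⁺ α y∈))
                 (All-resp-↭ sorted (atMax-≤ α<m β≤m)) y<m
  where
    sorted : α ++ m ∷ β ↭ stackSortF (suc f) (α ++ m ∷ β)
    sorted = ↭-sym (stackSortF-↭ (suc f) (α ++ m ∷ β) σ≤)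
...   | inLeft ancα | α≤ , _ rewrite stackSortF-atMax f α<m β≤m =
  Ancestor-++⁺ˡ (stackSortF f β ++ [ m ]) (stackSortF-Ancestor f α α≤ ancα)
...   | inRight ancβ | _ , β≤ rewrite stackSortF-atMax f α<m β≤m =
  Ancestor-++⁺ʳ (stackSortF f α) (Ancestor-++⁺ˡ [ m ] (stackSortF-Ancestor f β β≤ ancβ))

applyOps-length : ∀ A (θ : List ℕ) → length (applyOps A θ) ≡ length θ
applyOps-length [] θ = refl
applyOps-length (opS ∷ A) θ =
  trans (↭-length (stackSortF-↭ _ (applyOps A θ) ≤-refl)) (applyOps-length A θ)
applyOps-length (opR ∷ A) θ = trans (↭-length (↭-reverse (applyOps A θ))) (applyOps-length A θ)

applyOps-Ancestor : ∀ A θ {x y} → Ancestor θ x y → Ancestor (applyOps A θ) x y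
applyOps-Ancestor [] θ anc = anc
applyOps-Ancestor (opS ∷ A) θ anc = stackSortF-Ancestor _ (applyOps A θ) ≤-refl (applyOps-Ancestor A θ anc)
applyOps-Ancestor (opR ∷ A) θ anc = Ancestor-reverse⁺ (applyOps-Ancestor A θ anc)

range : ℕ → ℕ → List ℕ
range k zero = []
range k (suc n) = suc k ∷ range (suc k) n

range-length : ∀ k n → length (range k n) ≡ n
range-length k zero = refl
range-length k (suc n) = cong suc (range-length (suc k) n)

range-++ : ∀ k m n → range k (m + n) ≡ range k m ++ range (k + m) n
range-++ k zero n = cong (λ j → range j n) (sym (+-identityʳ k))
range-++ k (suc m) n =
  cong (suc k ∷_) (trans (range-++ (suc k) m n) (cong (λ j → range (suc k) m ++ range j n) (sym (+-suc k m))))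

range-atMax : ∀ k m n → range k (m + suc n) ≡ range k m ++ range (k + m) n ++ [ suc (k + m + n) ]
range-atMax k m n = begin
  range k (m + suc n)                                 ≡⟨ range-++ k m (suc n) ⟩
  range k m ++ range (k + m) (suc n)                  ≡⟨ cong (λ j → range k m ++ range (k + m) j) (+-comm 1 n) ⟩
  range k m ++ range (k + m) (n + 1)                  ≡⟨ cong (range k m ++_) (range-++ (k + m) n 1) ⟩
  range k m ++ range (k + m) n ++ [ suc (k + m + n) ] ∎
  where open ≡-Reasoning

applyUpTo-range : ∀ (g : ℕ → ℕ) k n → (∀ i → g i ≡ suc (k + i)) → applyUpTo g n ≡ range k n
applyUpTo-range g k zero _ = refl
applyUpTo-range g k (suc n) g≗ =
  cong₂ _∷_ (trans (g≗ 0) (cong suc (+-identityʳ k)))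
            (applyUpTo-range (g ∘ suc) (suc k) n (λ i → trans (g≗ (suc i)) (cong suc (+-suc k i))))

idPerm-range : ∀ n → idPerm n ≡ range 0 n
idPerm-range n = trans (map-upTo suc n) (applyUpTo-range suc 0 n (λ _ → refl))

-- The 231-avoiding arrangements of k+1, …, k+|σ|, generated by σ = α ⊕ (1 ⊖ β).
data Av231 (k : ℕ) : List ℕ → Set where
  [] : Av231 k []
  _⊕1⊖_ : ∀ {α β} → Av231 k α → Av231 (k + length α) β →
          Av231 k (α ++ suc (k + length α + length β) ∷ β)

Av231-> : ∀ {k σ} → Av231 k σ → All (k <_) σ
Av231-> [] = []
Av231-> {k} (pα ⊕1⊖ pβ) =
  ++⁺ (Av231-> pα)
      (s≤s (≤-trans (m≤m+n k _) (m≤m+n _ _)) ∷ All.map (≤-trans (s≤s (m≤m+n k _))) (Av231-> pβ))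

Av231-≤ : ∀ {k σ} → Av231 k σ → All (_≤ k + length σ) σ
Av231-≤ [] = []
Av231-≤ {k} (_⊕1⊖_ {α} {β} pα pβ) = subst (λ n → All (_≤ n) σ) (sym k+length≡top)
  (++⁺ (All.map (λ v≤ → ≤-trans v≤ (≤-trans (m≤m+n _ _) (n≤1+n _))) (Av231-≤ pα))
       (≤-refl ∷ All.map (λ v≤ → ≤-trans v≤ (n≤1+n _)) (Av231-≤ pβ)))
  where
    top : ℕ
    top = suc (k + length α + length β)
    σ : List ℕ
    σ = α ++ top ∷ β
    k+length≡top : k + length σ ≡ top
    k+length≡top = trans (cong (k +_) (length-++-∷ α β)) (trans (+-suc k _) (cong suc (sym (+-assoc k _ _))))

stackSortF≡range⇒Av231 : ∀ f k σ → length σ ≤ f → stackSortF f σ ≡ range k (length σ) → Av231 k σ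
stackSortF≡range⇒Av231 zero k [] _ _ = []
stackSortF≡range⇒Av231 (suc f) k σ σ≤ sorted with maxView σ
... | empty = []
... | atMax {α} {m} {β} α<m β≤m =
  subst (λ t → Av231 k (α ++ t ∷ β)) (sym m≡top)
    (stackSortF≡range⇒Av231 f k α α≤ (proj₁ α-part)
     ⊕1⊖ stackSortF≡range⇒Av231 f (k + a) β β≤ (proj₁ β-part))
  where
    a b : ℕ
    a = length α
    b = length β
    α≤ : a ≤ f
    α≤ = proj₁ (length-++-∷≤ α σ≤)
    β≤ : b ≤ f
    β≤ = proj₂ (length-++-∷≤ α σ≤)
    sorted-parts : stackSortF f α ++ stackSortF f β ++ [ m ] ≡
                   range k a ++ range (k + a) b ++ [ suc (k + a + b) ]
    sorted-parts = begin
      stackSortF f α ++ stackSortF f β ++ [ m ]           ≡⟨ sym (stackSortF-atMax f α<m β≤m) ⟩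
      stackSortF (suc f) (α ++ m ∷ β)                     ≡⟨ sorted ⟩
      range k (length (α ++ m ∷ β))                       ≡⟨ cong (range k) (length-++ α) ⟩
      range k (a + suc b)                                 ≡⟨ range-atMax k a b ⟩
      range k a ++ range (k + a) b ++ [ suc (k + a + b) ] ∎
      where open ≡-Reasoning
    length-sorted : ∀ j τ → length τ ≤ f → length (stackSortF f τ) ≡ length (range j (length τ))
    length-sorted j τ τ≤ = trans (↭-length (stackSortF-↭ f τ τ≤)) (sym (range-length j (length τ)))
    α-part : stackSortF f α ≡ range k a × stackSortF f β ++ [ m ] ≡ range (k + a) b ++ [ suc (k + a + b) ]
    α-part = ++-cancel-length (stackSortF f α) (range k a) _ _ (length-sorted k α α≤) sorted-parts
    β-part : stackSortF f β ≡ range (k + a) b × [ m ] ≡ [ suc (k + a + b) ]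
    β-part =
      ++-cancel-length (stackSortF f β) (range (k + a) b) _ _ (length-sorted (k + a) β β≤) (proj₂ α-part)
    m≡top : m ≡ suc (k + a + b)
    m≡top = proj₁ (∷-injective (proj₂ β-part))

Av231-shift : ∀ c {j k σ} → j ≡ k + c → Av231 j σ → Av231 k (map (_∸ c) σ)
Av231-shift c _ [] = []
Av231-shift c {k = k} refl (_⊕1⊖_ {α} {β} pα pβ) =
  subst (Av231 k) (sym shifted) (Av231-shift c refl pα ⊕1⊖ Av231-shift c index pβ)
  where
    a b : ℕ
    a = length α
    b = length β
    a′≡a : length (map (_∸ c) α) ≡ a
    a′≡a = length-map (_∸ c) α
    index : k + c + a ≡ k + length (map (_∸ c) α) + c
    index = trans (+-right-comm k c a) (cong (λ z → k + z + c) (sym a′≡a))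
    top≡ : suc (k + c + a + b) ∸ c ≡ suc (k + length (map (_∸ c) α) + length (map (_∸ c) β))
    top≡ = begin
      suc (k + c + a + b) ∸ c ≡⟨ cong (λ n → suc (n + b) ∸ c) (+-right-comm k c a) ⟩
      suc (k + a + c + b) ∸ c ≡⟨ cong (λ n → suc n ∸ c) (+-right-comm (k + a) c b) ⟩
      suc (k + a + b) + c ∸ c ≡⟨ m+n∸n≡m (suc (k + a + b)) c ⟩
      suc (k + a + b)         ≡⟨ cong₂ (λ u w → suc (k + u + w)) (sym a′≡a) (sym (length-map (_∸ c) β)) ⟩
      suc (k + length (map (_∸ c) α) + length (map (_∸ c) β)) ∎
      where open ≡-Reasoning
    shifted : map (_∸ c) (α ++ suc (k + c + a + b) ∷ β) ≡
              map (_∸ c) α ++ suc (k + length (map (_∸ c) α) + length (map (_∸ c) β)) ∷ map (_∸ c) β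
    shifted = trans (map-++ (_∸ c) α _) (cong (λ t → map (_∸ c) α ++ t ∷ map (_∸ c) β) top≡)

relabel-here : ∀ {v} xs y ys → relabel (v ∷ xs) (y ∷ ys) v ≡ y
relabel-here {v} _ _ _ rewrite ≡ᵇ-refl v = refl

relabel-there : ∀ {x v} xs y ys → x ≢ v → relabel (x ∷ xs) (y ∷ ys) v ≡ relabel xs ys v
relabel-there _ _ _ x≢v rewrite ≢⇒≡ᵇ≡false x≢v = refl

relabel-++ˡ : ∀ {v} p q r s → length p ≡ length r → v ∈ p → relabel (p ++ q) (r ++ s) v ≡ relabel p r v
relabel-++ˡ {v} (x ∷ p) q (y ∷ r) s _ _ with x ≟ v
relabel-++ˡ (x ∷ p) q (y ∷ r) s _ _ | yes refl =
  trans (relabel-here (p ++ q) y (r ++ s)) (sym (relabel-here p y r))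
relabel-++ˡ (x ∷ p) q (y ∷ r) s _ (here v≡x) | no x≢v = ⊥-elim (x≢v (sym v≡x))
relabel-++ˡ (x ∷ p) q (y ∷ r) s l (there v∈p) | no x≢v =
  trans (relabel-there (p ++ q) y (r ++ s) x≢v)
        (trans (relabel-++ˡ p q r s (suc-injective l) v∈p) (sym (relabel-there p y r x≢v)))

relabel-++ʳ : ∀ {v} p q r s → length p ≡ length r → v ∉ p → relabel (p ++ q) (r ++ s) v ≡ relabel q s v
relabel-++ʳ [] q [] s _ _ = refl
relabel-++ʳ (x ∷ p) q (y ∷ r) s l v∉ =
  trans (relabel-there (p ++ q) y (r ++ s) (λ x≡v → v∉ (here (sym x≡v))))
        (relabel-++ʳ p q r s (suc-injective l) (v∉ ∘ there))

relabel-map : ∀ {v} (h : ℕ → ℕ) p r → length p ≡ length r → v ∈ p → relabel p (map h r) v ≡ h (relabel p r v)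
relabel-map {v} h (x ∷ p) (y ∷ r) _ _ with x ≟ v
relabel-map h (x ∷ p) (y ∷ r) _ _ | yes refl =
  trans (relabel-here p (h y) (map h r)) (cong h (sym (relabel-here p y r)))
relabel-map h (x ∷ p) (y ∷ r) _ (here v≡x) | no x≢v = ⊥-elim (x≢v (sym v≡x))
relabel-map h (x ∷ p) (y ∷ r) l (there v∈p) | no x≢v =
  trans (relabel-there p (h y) (map h r) x≢v)
        (trans (relabel-map h p r (suc-injective l) v∈p) (cong h (sym (relabel-there p y r x≢v))))

relabel-mapKeys : ∀ {v} (g : ℕ → ℕ) p r → (∀ {u} → u ∈ p → g u ≡ g v → u ≡ v) →
                  relabel (map g p) r (g v) ≡ relabel p r v
relabel-mapKeys g [] r _ = refl
relabel-mapKeys g (x ∷ p) [] _ = refl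
relabel-mapKeys {v} g (x ∷ p) (y ∷ r) g-inj with x ≟ v
... | yes refl = trans (relabel-here (map g p) y r) (sym (relabel-here p y r))
... | no x≢v =
  trans (relabel-there (map g p) y r (x≢v ∘ g-inj (here refl)))
        (trans (relabel-mapKeys g p r (g-inj ∘ there)) (sym (relabel-there p y r x≢v)))

relabel-≤ : ∀ {v B} p r → All (_≤ B) r → relabel p r v ≤ B
relabel-≤ [] _ _ = z≤n
relabel-≤ (x ∷ p) [] _ = z≤n
relabel-≤ {v} (x ∷ p) (y ∷ r) (y≤ ∷ r≤) with x ≟ v
... | yes refl = subst (_≤ _) (sym (relabel-here p y r)) y≤
... | no x≢v = subst (_≤ _) (sym (relabel-there p y r x≢v)) (relabel-≤ p r r≤)

PF-length : ∀ f σ → length σ ≤ f → length (PF f σ) ≡ length σ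
PF-length zero [] _ = refl
PF-length (suc f) σ σ≤ with maxView σ
... | empty = refl
... | atMax {α} {m} {β} α<m β≤m rewrite PF-atMax f α<m β≤m = begin
    length (map (_+ b) (PF f α) ++ a + 1 + b ∷ PF f β′)  ≡⟨ length-++-∷ (map (_+ b) (PF f α)) (PF f β′) ⟩
    suc (length (map (_+ b) (PF f α)) + length (PF f β′)) ≡⟨ cong₂ (λ u w → suc (u + w)) length-α length-β ⟩
    suc (a + b)                                         ≡⟨ sym (length-++-∷ α β) ⟩
    length (α ++ m ∷ β)                                 ∎
  where
    open ≡-Reasoning
    a b : ℕ
    a = length α
    b = length β
    β′ : List ℕ
    β′ = map (_∸ a) β
    length-α : length (map (_+ b) (PF f α)) ≡ a
    length-α = trans (length-map _ (PF f α)) (PF-length f α (proj₁ (length-++-∷≤ α σ≤)))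
    length-β : length (PF f β′) ≡ b
    length-β = trans (PF-length f β′ (subst (_≤ f) (sym (length-map _ β)) (proj₂ (length-++-∷≤ α σ≤))))
                     (length-map _ β)

PF-≤ : ∀ f σ → length σ ≤ f → All (_≤ length σ) (PF f σ)
PF-≤ zero [] _ = []
PF-≤ (suc f) σ σ≤ with maxView σ
... | empty = []
... | atMax {α} {m} {β} α<m β≤m rewrite PF-atMax f α<m β≤m =
  subst (λ n → All (_≤ n) (map (_+ b) (PF f α) ++ a + 1 + b ∷ PF f β′)) (sym (length-++-∷ α β))
    (++⁺ (map⁺ (All.map (λ v≤a → ≤-trans (+-monoˡ-≤ b v≤a) (n≤1+n _)) (PF-≤ f α α≤f)))
         (≤-reflexive (m+1+n≡1+m+n a b) ∷ All.map (λ v≤ → ≤-trans v≤ β′≤) (PF-≤ f β′ β′≤f)))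
  where
    a b : ℕ
    a = length α
    b = length β
    β′ : List ℕ
    β′ = map (_∸ a) β
    α≤f : a ≤ f
    α≤f = proj₁ (length-++-∷≤ α σ≤)
    β′≤f : length β′ ≤ f
    β′≤f = subst (_≤ f) (sym (length-map _ β)) (proj₂ (length-++-∷≤ α σ≤))
    β′≤ : length β′ ≤ suc (a + b)
    β′≤ = ≤-trans (≤-reflexive (length-map _ β)) (≤-trans (m≤n+m b a) (n≤1+n _))

module PF-⊕1⊖ {k α β} (pα : Av231 k α) (pβ : Av231 (k + length α) β) where

  a b top : ℕ
  a = length α
  b = length β
  top = suc (k + a + b)

  σ β′ : List ℕ
  σ = α ++ top ∷ β
  β′ = map (_∸ a) β

  α≤ : All (_≤ k + a) α
  α≤ = Av231-≤ pα

  α<top : All (_< top) α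
  α<top = All.map (λ v≤ → s≤s (≤-trans v≤ (m≤m+n _ b))) α≤

  β≤top : All (_≤ top) β
  β≤top = All.map (λ v≤ → ≤-trans v≤ (n≤1+n _)) (Av231-≤ pβ)

  ∉α : ∀ {v} → k + a < v → v ∉ α
  ∉α k+a<v v∈α = <⇒≱ k+a<v (All.lookup α≤ v∈α)

  a≤β : ∀ {v} → v ∈ β → a ≤ v
  a≤β v∈β = ≤-trans (m≤n+m a k) (<⇒≤ (All.lookup (Av231-> pβ) v∈β))

  module _ (f : ℕ) (α≤f : a ≤ f) where

    private
      Qα : List ℕ
      Qα = PF f α
      Qβ : List ℕ
      Qβ = PF f β′
      length-Qα : a ≡ length (map (_+ b) Qα)
      length-Qα = sym (trans (length-map _ Qα) (PF-length f α α≤f))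

    relabel-PF-α : ∀ {v} → v ∈ α → relabel σ (PF (suc f) σ) v ≡ relabel α Qα v + b
    relabel-PF-α v∈α rewrite PF-atMax f α<top β≤top =
      trans (relabel-++ˡ α (top ∷ β) (map (_+ b) Qα) _ length-Qα v∈α)
            (relabel-map (_+ b) α Qα (sym (PF-length f α α≤f)) v∈α)

    relabel-PF-top : relabel σ (PF (suc f) σ) top ≡ a + 1 + b
    relabel-PF-top rewrite PF-atMax f α<top β≤top =
      trans (relabel-++ʳ α (top ∷ β) (map (_+ b) Qα) _ length-Qα (∉α (s≤s (m≤m+n (k + a) b))))
            (relabel-here β _ Qβ)

    relabel-PF-β : ∀ {v} → v ∈ β → relabel σ (PF (suc f) σ) v ≡ relabel β′ Qβ (v ∸ a)
    relabel-PF-β v∈β rewrite PF-atMax f α<top β≤top =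
      trans (relabel-++ʳ α (top ∷ β) (map (_+ b) Qα) _ length-Qα (∉α (All.lookup (Av231-> pβ) v∈β)))
            (trans (relabel-there β _ Qβ (<⇒≢ (s≤s (All.lookup (Av231-≤ pβ) v∈β)) ∘ sym))
                   (sym (relabel-mapKeys (_∸ a) β Qβ (λ u∈β → ∸-cancelʳ-≡ (a≤β u∈β) (a≤β v∈β)))))

    relabel-PF-<top : ∀ {v} → length β′ ≤ f → v ∈ α ++ β → relabel σ (PF (suc f) σ) v < a + 1 + b
    relabel-PF-<top β′≤f v∈ rewrite m+1+n≡1+m+n a b with ∈-++⁻ α v∈
    ... | inj₁ v∈α = subst (_< suc (a + b)) (sym (relabel-PF-α v∈α))
      (s≤s (+-monoˡ-≤ b (relabel-≤ α Qα (PF-≤ f α α≤f))))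
    ... | inj₂ v∈β = subst (_< suc (a + b)) (sym (relabel-PF-β v∈β))
      (s≤s (≤-trans (relabel-≤ β′ Qβ (PF-≤ f β′ β′≤f))
                    (≤-trans (≤-reflexive (length-map _ β)) (m≤n+m b a))))

relabel-PF-< : ∀ f {k σ x y} → length σ ≤ f → Av231 k σ → Ancestor σ x y →
               relabel σ (PF f σ) y < relabel σ (PF f σ) x
relabel-PF-< f _ [] anc with Ancestor-∈ anc
... | () , _
relabel-PF-< zero σ≤ (_⊕1⊖_ {α} {β} _ _) _ with subst (_≤ 0) (length-++-∷ α β) σ≤
... | ()
relabel-PF-< (suc f) {x = x} {y} σ≤ (_⊕1⊖_ {α} {β} pα pβ) anc =
  around (Ancestor-around (atMax-≤ α<top β≤top) anc)
  where
    open PF-⊕1⊖ pα pβ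
    α≤f : a ≤ f
    α≤f = proj₁ (length-++-∷≤ α σ≤)
    β′≤f : length β′ ≤ f
    β′≤f = subst (_≤ f) (sym (length-map _ β)) (proj₂ (length-++-∷≤ α σ≤))
    around : Around α top β x y → relabel σ (PF (suc f) σ) y < relabel σ (PF (suc f) σ) x
    around (inLeft ancα) with x∈α , y∈α ← Ancestor-∈ ancα =
      subst₂ _<_ (sym (relabel-PF-α f α≤f y∈α)) (sym (relabel-PF-α f α≤f x∈α))
        (+-monoˡ-< b (relabel-PF-< f α≤f pα ancα))
    around (inRight ancβ) with x∈β , y∈β ← Ancestor-∈ ancβ =
      subst₂ _<_ (sym (relabel-PF-β f α≤f y∈β)) (sym (relabel-PF-β f α≤f x∈β))
        (relabel-PF-< f β′≤f (Av231-shift a refl pβ)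
          (Ancestor-map⁺ (_∸ a) (∸-monoˡ-≤ a) (λ y<x → ∸-monoˡ-< y<x (a≤β y∈β)) ancβ))
    around (fromMax _ y∈) =
      subst (relabel σ (PF (suc f) σ) y <_) (sym (relabel-PF-top f α≤f)) (relabel-PF-<top f α≤f β′≤f y∈)

inorder-< : ∀ {v} t → RootBelow v t → IsDecreasing t → All (_< v) (inorder t)
inorder-< leaf _ _ = []
inorder-< (node l x r) x<v (l<x , r<x , dl , dr) =
  ++⁺ (All.map (λ u<x → <-trans u<x x<v) (inorder-< l l<x dl))
      (x<v ∷ All.map (λ u<x → <-trans u<x x<v) (inorder-< r r<x dr))

shape-≡ : ∀ (g : ℕ → ℕ) t₁ t₂ → IsDecreasing t₁ → IsDecreasing t₂ → inorder t₁ ≡ map g (inorder t₂) →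
          (∀ {x y} → Ancestor (inorder t₂) x y → g y < g x) → shape t₁ ≡ shape t₂
shape-≡ g leaf leaf _ _ _ _ = refl
shape-≡ g leaf (node l _ _) _ _ e _ = ⊥-elim ([]≢++∷ (map g (inorder l)) (trans e (map-++ g (inorder l) _)))
shape-≡ g (node l _ _) leaf _ _ e _ = ⊥-elim ([]≢++∷ (inorder l) (sym e))
shape-≡ g (node l₁ m₁ r₁) (node l₂ m₂ r₂) (l₁< , r₁< , dl₁ , dr₁) (l₂< , r₂< , dl₂ , dr₂) e g-< =
  cong₂ node (shape-≡ g l₁ l₂ dl₁ dl₂ (proj₁ subtrees) (g-< ∘ Ancestor-++⁺ˡ (m₂ ∷ rs)))
             (shape-≡ g r₁ r₂ dr₁ dr₂ (proj₂ subtrees) (g-< ∘ Ancestor-++⁺ʳ ls ∘ Ancestor-++⁺ʳ [ m₂ ]))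
  where
    ls rs : List ℕ
    ls = inorder l₂
    rs = inorder r₂
    ls<m₂ : All (_< m₂) ls
    ls<m₂ = inorder-< l₂ l₂< dl₂
    rs<m₂ : All (_< m₂) rs
    rs<m₂ = inorder-< r₂ r₂< dr₂
    below-root : ∀ {y} → y ∈ ls ++ m₂ ∷ rs → y < m₂ → g y < g m₂
    below-root y∈ y<m₂ = g-< (Ancestor-whole (∈-insert ls) y∈ (atMax-≤ ls<m₂ (All.map <⇒≤ rs<m₂)) y<m₂)
    subtrees : inorder l₁ ≡ map g ls × inorder r₁ ≡ map g rs
    subtrees = atMax-unique (inorder-< l₁ l₁< dl₁) (All.map <⇒≤ (inorder-< r₁ r₁< dr₁))
      (map⁺ (All.tabulate (λ y∈ls → below-root (∈-++⁺ˡ y∈ls) (All.lookup ls<m₂ y∈ls))))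
      (map⁺ (All.tabulate (λ y∈rs → <⇒≤ (below-root (∈-++⁺ʳ ls (there y∈rs)) (All.lookup rs<m₂ y∈rs)))))
      (trans e (map-++ g ls (m₂ ∷ rs)))

theorem4p10 : (A : List Op) (θ : List ℕ) → IsPerm θ → SortedBy A θ →
              (t₁ t₂ : BTree) → IsTin (Phi A θ) t₁ → IsTin θ t₂ →
              shape t₁ ≡ shape t₂
theorem4p10 A θ _ sorted t₁ t₂ (dec₁ , inorder₁) (dec₂ , refl) =
  shape-≡ (lam π) t₁ t₂ dec₁ dec₂ inorder₁
    (relabel-PF-< (length π) ≤-refl π∈Av231 ∘ applyOps-Ancestor A θ)
  where
    π : List ℕ
    π = applyOps A θ
    π∈Av231 : Av231 0 π
    π∈Av231 = stackSortF≡range⇒Av231 (length π) 0 π ≤-refl (begin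
      S π                ≡⟨ sorted ⟩
      idPerm (length θ)  ≡⟨ idPerm-range (length θ) ⟩
      range 0 (length θ) ≡⟨ cong (range 0) (sym (applyOps-length A θ)) ⟩
      range 0 (length π) ∎)
      where open ≡-Reasoning
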